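{- Let $H=C_a\square C_b$ be the toroidal grid with $a,b\geq 10$, let $n=ab$, and identify $V(H)$ with $[n]$. Then the set of all straight paths in $H$ with $4$ vertices is a resolving set for the Kneser graph $K(n,4)$. Therefore, for such $n$, $\beta(K(n,4))\leq 2n$.
   Context: The toroidal grid $C_a\square C_b$ has vertex set $\mathbb{Z}_a\times\mathbb{Z}_b$, with $(i,j)$ adjacent to $(i\pm1,j)$ and $(i,j\pm1)$. A straight path with $m$ vertices is a vertex set of the form $\{(i,j),(i+1,j),\dots,(i+m-1,j)\}$ or $\{(i,j),(i,j+1),\dots,(i,j+m-1)\}$ (so there are $2ab$ of them for each fixed $m$ smaller than $a,b$). The Kneser graph $K(n,k)$ has as vertices the $k$-subsets of $[n]$, adjacent when disjoint. A resolving set is a set $\mathcal{S}$ of vertices such that for all distinct vertices $U,W$ some $X\in\mathcal{S}$ has $d(U,X)\neq d(W,X)$; $\beta$ is the minimum size of a resolving set. -}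

module Defs where

open import Data.Nat using (ℕ; zero; suc; _+_; _*_; _<_; _≤_)
open import Data.Nat.DivMod using (_mod_)
open import Data.Fin using (Fin; toℕ; combine)
open import Data.Fin.Subset using (Subset; _∈_; ∣_∣)
open import Data.Product using (Σ; ∃; _×_; _,_; proj₁)
open import Data.Sum using (_⊎_)
open import Data.Empty using (⊥)
open import Data.List using (List; length)
open import Data.List.Membership.Propositional renaming (_∈_ to _∈L_)
open import Relation.Binary.PropositionalEquality using (_≡_; _≢_)

KVertex : ℕ → ℕ → Set
KVertex n k = Σ (Subset n) (λ U → ∣ U ∣ ≡ k)

Disjoint : ∀ {n} → Subset n → Subset n → Set
Disjoint U W = ∀ x → x ∈ U → x ∈ W → ⊥

KAdj : ∀ {n k} → KVertex n k → KVertex n k → Set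
KAdj U W = Disjoint (proj₁ U) (proj₁ W)

data Walk {n k : ℕ} : KVertex n k → KVertex n k → ℕ → Set where
  here  : ∀ {U} → Walk U U zero
  step  : ∀ {U V W m} → KAdj U V → Walk V W m → Walk U W (suc m)

Dist : ∀ {n k} → KVertex n k → KVertex n k → ℕ → Set
Dist U W m = Walk U W m × (∀ l → l < m → Walk U W l → ⊥)

Distinguishes : ∀ {n k} → KVertex n k → KVertex n k → KVertex n k → Set
Distinguishes X U W =
  ∃ λ m → ∃ λ m' → Dist U X m × Dist W X m' × m ≢ m'

Resolving : ∀ {n k} → (KVertex n k → Set) → Set
Resolving {n} {k} S =
  (U W : KVertex n k) → proj₁ U ≢ proj₁ W →
  ∃ λ X → S X × Distinguishes X U W

ResolvingList : ∀ {n k} → List (KVertex n k) → Set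
ResolvingList S = Resolving (λ X → X ∈L S)

MetricDimLe : ℕ → ℕ → ℕ → Set
MetricDimLe n k r = ∃ λ (S : List (KVertex n k)) → ResolvingList S × length S ≤ r

-- Toroidal grid C_a □ C_b, vertex set Z_a × Z_b, identified with
-- [a*b] via (i,j) ↦ combine i j  (= i * b + j).

Iff : Set → Set → Set
Iff P Q = (P → Q) × (Q → P)

shift : ∀ {a} → Fin a → ℕ → Fin a
shift {suc a} i t = (toℕ i + t) mod suc a

HorizPath : ∀ {a b} → ℕ → Fin a → Fin b → Subset (a * b) → Set
HorizPath {a} {b} m i j X =
  ∀ v → Iff (v ∈ X) (∃ λ t → t < m × v ≡ combine (shift i t) j)

VertPath : ∀ {a b} → ℕ → Fin a → Fin b → Subset (a * b) → Set
VertPath {a} {b} m i j X =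
  ∀ v → Iff (v ∈ X) (∃ λ t → t < m × v ≡ combine i (shift j t))

StraightPath : ∀ a b → ℕ → Subset (a * b) → Set
StraightPath a b m X =
  ∃ λ (i : Fin a) → ∃ λ (j : Fin b) → HorizPath m i j X ⊎ VertPath m i j X

module Submission where

-- 1. Distances in K(n,k) for n ≥ 3k are 0, 1 or 2 (equal, disjoint, or
--    intersecting and different).  So a vertex X meeting U and missing W
--    lies at distance 1 from W but not from U: it distinguishes U and W.
--    It suffices to find, for U ≠ W, a path meeting exactly one of them.
-- 2. Cross lemma (needs only a, b ≥ 7): if u = (i,j) ∉ Y, then either one
--    of the four straight 4-paths ending at u avoids Y, or Y contains two
--    further vertices of row j and two further vertices of column i.
-- 3. Take u ∈ U ∖ W and w ∈ W ∖ U.  If no path through u avoids W, the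
--    4-set W is the cross around u; say w lies in row j, so w is the only
--    vertex of W in its column.  If no path through w avoids U, then U has
--    a vertex u₁ ≠ w in that column, u₁ ∉ W, and if no path through u₁
--    avoided W then W would have two vertices in that column.  The argument
--    is stated for an abstract grid, so that the case of w in column i
--    follows from the row case by transposing the grid.
-- 4. Listing one horizontal and one vertical path per vertex gives a
--    resolving list of length 2n.

open import Defs
open import Function using (_∘_)
open import Data.Nat using (ℕ; zero; suc; _+_; _*_; _∸_; _<_; _≤_; z≤n; s≤s; _%_; _/_)
open import Data.Nat.Properties hiding (_≟_)
open import Data.Nat.DivMod using (m≡m%n+[m/n]*n; [m+n]%n≡m%n; m<n⇒m%n≡m; %-distribˡ-+; m%n%n≡m%n)
open import Data.Fin using (Fin; zero; suc; toℕ; combine; remQuot)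
open import Data.Fin.Properties
  using (_≟_; any?; toℕ-fromℕ<; toℕ-injective; toℕ<n; combine-injectiveˡ; combine-injective;
         combine-remQuot; remQuot-combine)
open import Data.Fin.Subset
  using (Subset; _∈_; _∉_; _⊆_; ∣_∣; ⁅_⁆; _∪_; ∁; inside; outside) renaming (⊥ to ∅)
open import Data.Fin.Subset.Properties
  using (_∈?_; ∉⊥; ∣⊥∣≡0; ⊆-antisym; p⊆q⇒∣p∣≤∣q∣; p⊂q⇒∣p∣<∣q∣; x∈p∪q⁺; x∈p∪q⁻; x∈⁅x⁆;
         x∈⁅y⁆⇒x≡y; ∪-identityˡ; ∣∁p∣≡n∸∣p∣; x∈∁p⇒x∉p; in⊆in; s⊆s)
open import Data.Vec using ([]; _∷_)
import Data.Vec as Vec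
open import Data.Vec.Properties using (≡-dec)
import Data.Bool.Properties as Bool
open import Data.List using (List; []; _∷_; length; map; _++_; foldr; applyUpTo; allFin)
open import Data.List.Properties using (length-applyUpTo; length-map; length-++; length-tabulate)
open import Data.List.Membership.Propositional using () renaming (_∈_ to _∈ₗ_)
open import Data.List.Membership.Propositional.Properties
  using (∈-applyUpTo⁺; ∈-applyUpTo⁻; ∈-map⁺; ∈-++⁺ˡ; ∈-++⁺ʳ; ∈-allFin)
open import Data.List.Relation.Unary.Any using (here; there)
import Data.List.Relation.Unary.Any as Any
open import Data.List.Relation.Unary.All using (All; []; _∷_)
import Data.List.Relation.Unary.All as All
open import Data.List.Relation.Unary.All.Properties using (¬Any⇒All¬; All¬⇒¬Any)
open import Data.List.Relation.Unary.AllPairs using ([]; _∷_)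
open import Data.List.Relation.Unary.Unique.Propositional using (Unique)
open import Data.List.Relation.Unary.Unique.Propositional.Properties using (applyUpTo⁺₁)
open import Data.Product using (∃; _×_; _,_; proj₁; proj₂; swap)
open import Data.Sum using (_⊎_; inj₁; inj₂; map₂)
open import Data.Empty using (⊥; ⊥-elim)
open import Relation.Nullary using (yes; no; ¬?)
open import Relation.Nullary.Decidable using (_×-dec_)
open import Relation.Binary.PropositionalEquality
  using (_≡_; _≢_; refl; sym; trans; cong; cong₂; subst; module ≡-Reasoning)

Meets : ∀ {n} → Subset n → Subset n → Set
Meets p q = ∃ λ x → x ∈ p × x ∈ q

disjoint-sym : ∀ {n} {p q : Subset n} → Disjoint p q → Disjoint q p
disjoint-sym p∩q=∅ x x∈q x∈p = p∩q=∅ x x∈p x∈q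

⊇-of-same-size : ∀ {n} {p q : Subset n} → p ⊆ q → ∣ q ∣ ≤ ∣ p ∣ → q ⊆ p
⊇-of-same-size {p = p} p⊆q ∣q∣≤∣p∣ {x} x∈q with x ∈? p
... | yes x∈p = x∈p
... | no x∉p = ⊥-elim (<⇒≱ (p⊂q⇒∣p∣<∣q∣ (p⊆q , x , x∈q , x∉p)) ∣q∣≤∣p∣)

∃-difference : ∀ {n} {p q : Subset n} → p ≢ q → ∣ p ∣ ≡ ∣ q ∣ → ∃ λ x → x ∈ p × x ∉ q
∃-difference {p = p} {q} p≢q ∣p∣≡∣q∣ with any? (λ x → x ∈? p ×-dec ¬? (x ∈? q))
... | yes witness = witness
... | no none = ⊥-elim (p≢q (⊆-antisym p⊆q (⊇-of-same-size p⊆q (≤-reflexive (sym ∣p∣≡∣q∣)))))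
  where
    p⊆q : p ⊆ q
    p⊆q {x} x∈p with x ∈? q
    ... | yes x∈q = x∈q
    ... | no x∉q = ⊥-elim (none (x , x∈p , x∉q))

same-members : ∀ {n} {p q : Subset n} (P : Fin n → Set) →
               (∀ v → Iff (v ∈ p) (P v)) → (∀ v → Iff (v ∈ q) (P v)) → p ≡ q
same-members P p≈P q≈P =
  ⊆-antisym (λ {v} v∈p → proj₂ (q≈P v) (proj₁ (p≈P v) v∈p))
            (λ {v} v∈q → proj₂ (p≈P v) (proj₁ (q≈P v) v∈q))

∣p∪q∣≤∣p∣+∣q∣ : ∀ {n} (p q : Subset n) → ∣ p ∪ q ∣ ≤ ∣ p ∣ + ∣ q ∣
∣p∪q∣≤∣p∣+∣q∣ []            []            = z≤n
∣p∪q∣≤∣p∣+∣q∣ (inside ∷ p)  (inside ∷ q)  =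
  s≤s (≤-trans (∣p∪q∣≤∣p∣+∣q∣ p q) (+-monoʳ-≤ ∣ p ∣ (n≤1+n ∣ q ∣)))
∣p∪q∣≤∣p∣+∣q∣ (inside ∷ p)  (outside ∷ q) = s≤s (∣p∪q∣≤∣p∣+∣q∣ p q)
∣p∪q∣≤∣p∣+∣q∣ (outside ∷ p) (inside ∷ q)  =
  ≤-trans (s≤s (∣p∪q∣≤∣p∣+∣q∣ p q)) (≤-reflexive (sym (+-suc ∣ p ∣ ∣ q ∣)))
∣p∪q∣≤∣p∣+∣q∣ (outside ∷ p) (outside ∷ q) = ∣p∪q∣≤∣p∣+∣q∣ p q

k-subset : ∀ {n} k (p : Subset n) → k ≤ ∣ p ∣ → ∃ λ q → q ⊆ p × ∣ q ∣ ≡ k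
k-subset {n} zero p          _         = ∅ , (λ x∈∅ → ⊥-elim (∉⊥ x∈∅)) , ∣⊥∣≡0 n
k-subset (suc k) []            ()
k-subset (suc k) (inside ∷ p)  (s≤s k≤p) =
  let q , q⊆p , ∣q∣≡k = k-subset k p k≤p in inside ∷ q , in⊆in q⊆p , cong suc ∣q∣≡k
k-subset (suc k) (outside ∷ p) k<p       =
  let q , q⊆p , ∣q∣≡k = k-subset (suc k) p k<p in outside ∷ q , s⊆s q⊆p , ∣q∣≡k

avoiding-set : ∀ {n} k (C : Subset n) → k + ∣ C ∣ ≤ n → ∃ λ (V : KVertex n k) → Disjoint (proj₁ V) C
avoiding-set k C room
  with k-subset k (∁ C) (subst (k ≤_) (sym (∣∁p∣≡n∸∣p∣ C)) (m+n≤o⇒m≤o∸n k room))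
... | V , V⊆∁C , ∣V∣≡k = (V , ∣V∣≡k) , λ x x∈V x∈C → x∈∁p⇒x∉p (V⊆∁C x∈V) x∈C

⟦_⟧ : ∀ {n} → List (Fin n) → Subset n
⟦ xs ⟧ = foldr (λ x p → ⁅ x ⁆ ∪ p) ∅ xs

∈⟦⟧⁺ : ∀ {n} {x : Fin n} {xs} → x ∈ₗ xs → x ∈ ⟦ xs ⟧
∈⟦⟧⁺ (here refl)  = x∈p∪q⁺ (inj₁ (x∈⁅x⁆ _))
∈⟦⟧⁺ (there x∈xs) = x∈p∪q⁺ (inj₂ (∈⟦⟧⁺ x∈xs))

∈⟦⟧⁻ : ∀ {n} {x : Fin n} xs → x ∈ ⟦ xs ⟧ → x ∈ₗ xs
∈⟦⟧⁻ []       x∈∅ = ⊥-elim (∉⊥ x∈∅)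
∈⟦⟧⁻ (y ∷ xs) x∈  with x∈p∪q⁻ ⁅ y ⁆ ⟦ xs ⟧ x∈
... | inj₁ x∈⁅y⁆ = here (x∈⁅y⁆⇒x≡y y x∈⁅y⁆)
... | inj₂ x∈xs  = there (∈⟦⟧⁻ xs x∈xs)

∣⁅x⁆∪p∣ : ∀ {n} (x : Fin n) (p : Subset n) → x ∉ p → ∣ ⁅ x ⁆ ∪ p ∣ ≡ suc ∣ p ∣
∣⁅x⁆∪p∣ zero    (inside ∷ p)  x∉p = ⊥-elim (x∉p Vec.here)
∣⁅x⁆∪p∣ zero    (outside ∷ p) _   = cong (suc ∘ ∣_∣) (∪-identityˡ p)
∣⁅x⁆∪p∣ (suc x) (inside ∷ p)  x∉p = cong suc (∣⁅x⁆∪p∣ x p (x∉p ∘ Vec.there))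
∣⁅x⁆∪p∣ (suc x) (outside ∷ p) x∉p = ∣⁅x⁆∪p∣ x p (x∉p ∘ Vec.there)

∣⟦⟧∣ : ∀ {n} {xs : List (Fin n)} → Unique xs → ∣ ⟦ xs ⟧ ∣ ≡ length xs
∣⟦⟧∣ {n} {[]}     []                  = ∣⊥∣≡0 n
∣⟦⟧∣ {xs = x ∷ xs} (x∉xs ∷ distinct) =
  trans (∣⁅x⁆∪p∣ x ⟦ xs ⟧ (All¬⇒¬Any x∉xs ∘ ∈⟦⟧⁻ xs)) (cong suc (∣⟦⟧∣ distinct))

unique-length≤ : ∀ {n} {Y : Subset n} {xs} → Unique xs → All (_∈ Y) xs → length xs ≤ ∣ Y ∣
unique-length≤ {xs = xs} distinct xs⊆Y =
  ≤-trans (≤-reflexive (sym (∣⟦⟧∣ distinct))) (p⊆q⇒∣p∣≤∣q∣ (All.lookup xs⊆Y ∘ ∈⟦⟧⁻ xs))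

saturated : ∀ {n} {Y : Subset n} {xs} → Unique xs → All (_∈ Y) xs → ∣ Y ∣ ≡ length xs →
            ∀ {y} → y ∈ Y → y ∈ₗ xs
saturated {xs = xs} distinct xs⊆Y ∣Y∣≡ {y} y∈Y with Any.any? (y ≟_) xs
... | yes y∈xs = y∈xs
... | no y∉xs  = ⊥-elim (1+n≰n (≤-trans (unique-length≤ (¬Any⇒All¬ xs y∉xs ∷ distinct) (y∈Y ∷ xs⊆Y))
                                         (≤-reflexive ∣Y∣≡)))

range : ∀ {n} → (ℕ → Fin n) → ℕ → Subset n
range f m = ⟦ applyUpTo f m ⟧

range-∈ : ∀ {n} (f : ℕ → Fin n) m v → Iff (v ∈ range f m) (∃ λ t → t < m × v ≡ f t)
range-∈ f m v = ∈-applyUpTo⁻ f ∘ ∈⟦⟧⁻ _ , λ { (t , t<m , refl) → ∈⟦⟧⁺ (∈-applyUpTo⁺ f t<m) }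

range-size : ∀ {n} (f : ℕ → Fin n) m → (∀ {s t} → s < t → t < m → f s ≢ f t) → ∣ range f m ∣ ≡ m
range-size f m distinct = trans (∣⟦⟧∣ (applyUpTo⁺₁ f m distinct)) (length-applyUpTo f m)


vertex-≡ : ∀ {n k} {U X : KVertex n k} → proj₁ U ≡ proj₁ X → U ≡ X
vertex-≡ {U = _ , e} {X = _ , e'} refl = cong (_ ,_) (≡-irrelevant e e')

Separates : ∀ {n} → Subset n → Subset n → Subset n → Set
Separates X U W = (Meets X U × Disjoint X W) ⊎ (Meets X W × Disjoint X U)

-- Distances in K(n,k) when n ≥ 3k, so that any two vertices have a common neighbour.
module Kneser {n k : ℕ} (room : 3 * k ≤ n) where

  walk-0 : {U X : KVertex n k} → Walk U X 0 → U ≡ X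
  walk-0 here = refl

  dist-0 : (U X : KVertex n k) → proj₁ U ≡ proj₁ X → Dist U X 0
  dist-0 U X U≡X = subst (λ Z → Dist U Z 0) (vertex-≡ U≡X) (here , λ _ ())

  -- A disjoint, nonempty X is a neighbour and different from U.
  dist-1 : (U X : KVertex n k) {x : Fin n} → Disjoint (proj₁ U) (proj₁ X) → x ∈ proj₁ X → Dist U X 1
  dist-1 U X {x} U∩X=∅ x∈X = step U∩X=∅ here , shorter
    where
      shorter : ∀ l → l < 1 → Walk U X l → ⊥
      shorter zero    _          w = U∩X=∅ x (subst (λ Z → x ∈ proj₁ Z) (sym (walk-0 w)) x∈X) x∈X
      shorter (suc l) (s≤s ()) _

  -- Two different intersecting vertices have a common neighbour avoiding both.
  dist-2 : (U X : KVertex n k) → proj₁ U ≢ proj₁ X → Meets (proj₁ U) (proj₁ X) → Dist U X 2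
  dist-2 U X U≢X (x , x∈U , x∈X) = step {V = V} U∩V=∅ (step V∩X=∅ here) , shorter
    where
      room' : k + ∣ proj₁ U ∪ proj₁ X ∣ ≤ n
      room' = begin
        k + ∣ proj₁ U ∪ proj₁ X ∣        ≤⟨ +-monoʳ-≤ k (∣p∪q∣≤∣p∣+∣q∣ (proj₁ U) (proj₁ X)) ⟩
        k + (∣ proj₁ U ∣ + ∣ proj₁ X ∣)  ≡⟨ cong (k +_) (cong₂ _+_ (proj₂ U) (proj₂ X)) ⟩
        k + (k + k)                      ≡⟨ cong (λ z → k + (k + z)) (sym (+-identityʳ k)) ⟩
        3 * k                            ≤⟨ room ⟩
        n                                ∎
        where open ≤-Reasoning
      common : ∃ λ (V : KVertex n k) → Disjoint (proj₁ V) (proj₁ U ∪ proj₁ X)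
      common = avoiding-set k (proj₁ U ∪ proj₁ X) room'
      V : KVertex n k
      V = proj₁ common
      U∩V=∅ : Disjoint (proj₁ U) (proj₁ V)
      U∩V=∅ y y∈U y∈V = proj₂ common y y∈V (x∈p∪q⁺ (inj₁ y∈U))
      V∩X=∅ : Disjoint (proj₁ V) (proj₁ X)
      V∩X=∅ y y∈V y∈X = proj₂ common y y∈V (x∈p∪q⁺ (inj₂ y∈X))
      shorter : ∀ l → l < 2 → Walk U X l → ⊥
      shorter 0 _ w = U≢X (cong proj₁ (walk-0 w))
      shorter 1 _ (step U∩Z=∅ w) = U∩Z=∅ x x∈U (subst (λ Z → x ∈ proj₁ Z) (sym (walk-0 w)) x∈X)
      shorter (suc (suc l)) (s≤s (s≤s ())) _

  meeting-distance : (U X : KVertex n k) → Meets (proj₁ U) (proj₁ X) → ∃ λ m → Dist U X m × m ≢ 1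
  meeting-distance U X U∩X with ≡-dec Bool._≟_ (proj₁ U) (proj₁ X)
  ... | yes U≡X = 0 , dist-0 U X U≡X , λ ()
  ... | no U≢X  = 2 , dist-2 U X U≢X U∩X , λ ()

  separates⇒distinguishes : (X U W : KVertex n k) → Separates (proj₁ X) (proj₁ U) (proj₁ W) →
                            Distinguishes X U W
  separates⇒distinguishes X U W (inj₁ ((x , x∈X , x∈U) , X∩W=∅))
    with meeting-distance U X (x , x∈U , x∈X)
  ... | m , d , m≢1 = m , 1 , d , dist-1 W X (disjoint-sym X∩W=∅) x∈X , m≢1
  separates⇒distinguishes X U W (inj₂ ((x , x∈X , x∈W) , X∩U=∅))
    with meeting-distance W X (x , x∈W , x∈X)
  ... | m , d , m≢1 = 1 , m , dist-1 U X (disjoint-sym X∩U=∅) x∈X , d , m≢1 ∘ sym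

  resolving-by-separation : {S : KVertex n k → Set} →
    ((U W : KVertex n k) → proj₁ U ≢ proj₁ W → ∃ λ X → S X × Separates (proj₁ X) (proj₁ U) (proj₁ W)) →
    Resolving S
  resolving-by-separation separate U W U≢W =
    let X , X∈S , sep = separate U W U≢W in X , X∈S , separates⇒distinguishes X U W sep

resolving-mono : ∀ {n k} {S T : KVertex n k → Set} → (∀ X → S X → T X) → Resolving S → Resolving T
resolving-mono S⊆T resolves U W U≢W =
  let X , X∈S , dist = resolves U W U≢W in X , S⊆T X X∈S , dist


AvoidingPath : ∀ {n k} → (KVertex n k → Set) → Fin n → Subset n → Set
AvoidingPath SP x Y = ∃ λ P → SP P × x ∈ proj₁ P × Disjoint (proj₁ P) Y

record Flanks {n} {L : Set} (g : L → Fin n) (x₀ : L) (Y : Subset n) : Set where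
  field
    x₁ x₂  : L
    x₁≢x₀  : x₁ ≢ x₀
    x₂≢x₀  : x₂ ≢ x₀
    x₁≢x₂  : x₁ ≢ x₂
    gx₁∈Y  : g x₁ ∈ Y
    gx₂∈Y  : g x₂ ∈ Y

open Flanks

flanks-swap : ∀ {n} {L : Set} {g : L → Fin n} {x₀ Y} → Flanks g x₀ Y → Flanks g x₀ Y
flanks-swap F = record
  { x₁ = x₂ F ; x₂ = x₁ F ; x₁≢x₀ = x₂≢x₀ F ; x₂≢x₀ = x₁≢x₀ F
  ; x₁≢x₂ = x₁≢x₂ F ∘ sym ; gx₁∈Y = gx₂∈Y F ; gx₂∈Y = gx₁∈Y F }

Cross : ∀ {n} {I J : Set} → (I → J → Fin n) → I → J → Subset n → Set
Cross pt i j Y = Flanks (λ c → pt c j) i Y × Flanks (pt i) j Y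

record Grid {n : ℕ} (SP : KVertex n 4 → Set) : Set₁ where
  field
    I J           : Set
    pt            : I → J → Fin n
    pt-injective  : ∀ {i i' j j'} → pt i j ≡ pt i' j' → i ≡ i' × j ≡ j'
    pt-surjective : ∀ v → ∃ λ i → ∃ λ j → v ≡ pt i j
    cross         : ∀ i j (Y : Subset n) → pt i j ∉ Y → AvoidingPath SP (pt i j) Y ⊎ Cross pt i j Y

transpose : ∀ {n} {SP : KVertex n 4 → Set} → Grid SP → Grid SP
transpose G = record
  { I = J ; J = I ; pt = λ j i → pt i j
  ; pt-injective = swap ∘ pt-injective
  ; pt-surjective = λ v → let i , j , v≡ij = pt-surjective v in j , i , v≡ij
  ; cross = λ j i Y ij∉Y → map₂ swap (cross i j Y ij∉Y) }
  where open Grid G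

module GridSeparation {n : ℕ} {SP : KVertex n 4 → Set} where

  Separated : KVertex n 4 → KVertex n 4 → Set
  Separated U W = ∃ λ X → SP X × Separates (proj₁ X) (proj₁ U) (proj₁ W)

  path-in-U : ∀ U W {x} → x ∈ proj₁ U → AvoidingPath SP x (proj₁ W) → Separated U W
  path-in-U _ _ x∈U (P , P∈SP , x∈P , P∩W=∅) = P , P∈SP , inj₁ ((_ , x∈P , x∈U) , P∩W=∅)

  path-in-W : ∀ U W {x} → x ∈ proj₁ W → AvoidingPath SP x (proj₁ U) → Separated U W
  path-in-W _ _ x∈W (P , P∈SP , x∈P , P∩U=∅) = P , P∈SP , inj₂ ((_ , x∈P , x∈W) , P∩U=∅)

  module RowCase (G : Grid SP) where
    open Grid G

    cross-points : ∀ {i j Y} → Cross pt i j Y → List (Fin n)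
    cross-points {i} {j} (h , v) = pt (x₁ h) j ∷ pt (x₂ h) j ∷ pt i (x₁ v) ∷ pt i (x₂ v) ∷ []

    cross-saturates : ∀ {i j} (W : KVertex n 4) (C : Cross pt i j (proj₁ W)) →
                      ∀ {y} → y ∈ proj₁ W → y ∈ₗ cross-points C
    cross-saturates {i} {j} W (h , v) = saturated distinct (gx₁∈Y h ∷ gx₂∈Y h ∷ gx₁∈Y v ∷ gx₂∈Y v ∷ []) (proj₂ W)
      where
        column≢ : ∀ {c c' r r'} → c ≢ c' → pt c r ≢ pt c' r'
        column≢ c≢c' = c≢c' ∘ proj₁ ∘ pt-injective
        distinct : Unique (cross-points {i} {j} {proj₁ W} (h , v))
        distinct = (column≢ (x₁≢x₂ h) ∷ column≢ (x₁≢x₀ h) ∷ column≢ (x₁≢x₀ h) ∷ [])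
                 ∷ (column≢ (x₂≢x₀ h) ∷ column≢ (x₂≢x₀ h) ∷ [])
                 ∷ ((x₁≢x₂ v ∘ proj₂ ∘ pt-injective) ∷ [])
                 ∷ [] ∷ []

    first-column : ∀ {i j} (W : KVertex n 4) (C : Cross pt i j (proj₁ W)) →
                   ∀ {r} → pt (x₁ (proj₁ C)) r ∈ proj₁ W → r ≡ j
    first-column W C@(h , _) m with cross-saturates W C m
    ... | here e                         = proj₂ (pt-injective e)
    ... | there (here e)                 = ⊥-elim (x₁≢x₂ h (proj₁ (pt-injective e)))
    ... | there (there (here e))         = ⊥-elim (x₁≢x₀ h (proj₁ (pt-injective e)))
    ... | there (there (there (here e))) = ⊥-elim (x₁≢x₀ h (proj₁ (pt-injective e)))

    row-case : ∀ {i j} (U W : KVertex n 4) (C : Cross pt i j (proj₁ W)) →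
               pt (x₁ (proj₁ C)) j ∉ proj₁ U → Separated U W
    row-case {j = j} U W C w∉U = through-w (cross c j (proj₁ U) w∉U)
      where
        c : I
        c = x₁ (proj₁ C)
        through-w : AvoidingPath SP (pt c j) (proj₁ U) ⊎ Cross pt c j (proj₁ U) → Separated U W
        through-w (inj₁ P)       = path-in-W U W (gx₁∈Y (proj₁ C)) P
        through-w (inj₂ (_ , D)) = through-u₁ (cross c (x₁ D) (proj₁ W) (x₁≢x₀ D ∘ first-column W C))
          where
            -- u₁ = (c, x₁ D) ∈ U ∖ W; a cross around u₁ would put two points of W in column c.
            through-u₁ : AvoidingPath SP (pt c (x₁ D)) (proj₁ W) ⊎ Cross pt c (x₁ D) (proj₁ W) →
                         Separated U W
            through-u₁ (inj₁ P)       = path-in-U U W (gx₁∈Y D) P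
            through-u₁ (inj₂ (_ , E)) =
              ⊥-elim (x₁≢x₂ E (trans (first-column W C (gx₁∈Y E)) (sym (first-column W C (gx₂∈Y E)))))

  module _ (G : Grid SP) where
    open Grid G
    open RowCase G using (cross-saturates; row-case)
    private module Transposed = RowCase (transpose G)

    separated : (U W : KVertex n 4) → proj₁ U ≢ proj₁ W → Separated U W
    separated U W U≢W with ∃-difference U≢W (trans (proj₂ U) (sym (proj₂ W)))
    ... | u , u∈U , u∉W with pt-surjective u
    ... | i , j , refl with cross i j (proj₁ W) u∉W
    ... | inj₁ P = path-in-U U W u∈U P
    ... | inj₂ C@(h , v) with ∃-difference (U≢W ∘ sym) (trans (proj₂ W) (sym (proj₂ U)))
    ... | w , w∈W , w∉U with cross-saturates W C w∈W
    ... | here refl                         = row-case U W C w∉U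
    ... | there (here refl)                 = row-case U W (flanks-swap h , v) w∉U
    ... | there (there (here refl))         = Transposed.row-case U W (v , h) w∉U
    ... | there (there (there (here refl))) = Transposed.row-case U W (flanks-swap v , h) w∉U


module Cycle {a : ℕ} where
  open ≡-Reasoning


  toℕ-shift : (i : Fin (suc a)) (t : ℕ) → toℕ (shift i t) ≡ (toℕ i + t) % suc a
  toℕ-shift i t = toℕ-fromℕ< _

  shift-+ : ∀ (i : Fin (suc a)) m k → shift (shift i m) k ≡ shift i (m + k)
  shift-+ i m k = toℕ-injective (begin
    toℕ (shift (shift i m) k)             ≡⟨ toℕ-shift (shift i m) k ⟩
    (toℕ (shift i m) + k) % N             ≡⟨ cong (λ z → (z + k) % N) (toℕ-shift i m) ⟩
    ((toℕ i + m) % N + k) % N             ≡⟨ %-distribˡ-+ ((toℕ i + m) % N) k N ⟩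
    ((toℕ i + m) % N % N + k % N) % N     ≡⟨ cong (λ z → (z + k % N) % N) (m%n%n≡m%n (toℕ i + m) N) ⟩
    ((toℕ i + m) % N + k % N) % N         ≡⟨ sym (%-distribˡ-+ (toℕ i + m) k N) ⟩
    (toℕ i + m + k) % N                   ≡⟨ cong (_% N) (+-assoc (toℕ i) m k) ⟩
    (toℕ i + (m + k)) % N                 ≡⟨ sym (toℕ-shift i (m + k)) ⟩
    toℕ (shift i (m + k))                 ∎)
    where
      N : ℕ
      N = suc a

  shift-0 : (i : Fin (suc a)) → shift i 0 ≡ i
  shift-0 i = toℕ-injective (trans (toℕ-shift i 0)
                (trans (cong (_% suc a) (+-identityʳ (toℕ i))) (m<n⇒m%n≡m (toℕ<n i))))

  shift-period : (i : Fin (suc a)) → shift i (suc a) ≡ i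
  shift-period i = toℕ-injective (trans (toℕ-shift i (suc a))
                     (trans ([m+n]%n≡m%n (toℕ i) (suc a)) (m<n⇒m%n≡m (toℕ<n i))))

  below-multiple : ∀ {k N} q → k < N → k ≡ q * N → k ≡ 0
  below-multiple zero    _   k≡0 = k≡0
  below-multiple {N = N} (suc q) k<N refl = ⊥-elim (<⇒≱ k<N (m≤m+n N (q * N)))

  shift-fixed : ∀ (j : Fin (suc a)) k → k < suc a → shift j k ≡ j → k ≡ 0
  shift-fixed j k k<N jk≡j = below-multiple q k<N (+-cancelˡ-≡ (toℕ j) k (q * suc a) (begin
    toℕ j + k                         ≡⟨ m≡m%n+[m/n]*n (toℕ j + k) (suc a) ⟩
    (toℕ j + k) % suc a + q * suc a   ≡⟨ cong (_+ q * suc a) (trans (sym (toℕ-shift j k)) (cong toℕ jk≡j)) ⟩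
    toℕ j + q * suc a                 ∎))
    where
      q : ℕ
      q = (toℕ j + k) / suc a

  shift-gap : ∀ (i : Fin (suc a)) {m m'} → m ≤ m' → m' < suc a → shift i m ≡ shift i m' → m' ≡ m
  shift-gap i {m} {m'} m≤m' m'<N eq = begin
    m'             ≡⟨ sym (m+[n∸m]≡n m≤m') ⟩
    m + (m' ∸ m)   ≡⟨ cong (m +_) gap≡0 ⟩
    m + 0          ≡⟨ +-identityʳ m ⟩
    m              ∎
    where
      gap≡0 : m' ∸ m ≡ 0
      gap≡0 = shift-fixed (shift i m) (m' ∸ m) (≤-<-trans (m∸n≤m m' m) m'<N) (begin
        shift (shift i m) (m' ∸ m)  ≡⟨ shift-+ i m (m' ∸ m) ⟩
        shift i (m + (m' ∸ m))      ≡⟨ cong (shift i) (m+[n∸m]≡n m≤m') ⟩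
        shift i m'                  ≡⟨ sym eq ⟩
        shift i m                   ∎)

  shift-injective : ∀ (i : Fin (suc a)) {m m'} → m < suc a → m' < suc a → shift i m ≡ shift i m' → m ≡ m'
  shift-injective i {m} {m'} m<N m'<N eq with ≤-total m m'
  ... | inj₁ m≤m' = sym (shift-gap i m≤m' m'<N eq)
  ... | inj₂ m'≤m = shift-gap i m'≤m m<N (sym eq)

  back : ℕ → Fin (suc a) → Fin (suc a)
  back k i = shift i (suc a ∸ k)

  shift-back : ∀ {k} (i : Fin (suc a)) → k ≤ suc a → shift (back k i) k ≡ i
  shift-back {k} i k≤N = begin
    shift (shift i (suc a ∸ k)) k   ≡⟨ shift-+ i (suc a ∸ k) k ⟩
    shift i (suc a ∸ k + k)         ≡⟨ cong (shift i) (m∸n+n≡m k≤N) ⟩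
    shift i (suc a)                 ≡⟨ shift-period i ⟩
    i                               ∎

open Cycle


left≢right : ∀ {t₁ t₂} → t₁ < 4 → t₂ ≢ 0 → t₁ ≢ 3 + t₂
left≢right {t₂ = zero}   _    t₂≢0 = ⊥-elim (t₂≢0 refl)
left≢right {t₂ = suc t₂} t₁<4 _    = <⇒≢ (<-≤-trans t₁<4 (m≤m+n 4 t₂))

-- Offsets of the segments ending at a vertex i range over [0,7) from back 3 i.
below-7 : ∀ {t} → t < 4 → t < 7
below-7 t<4 = ≤-trans t<4 (m≤m+n 4 3)

module Line {n a : ℕ} {SP : KVertex n 4 → Set} (7≤N : 7 ≤ suc a)
            (g : Fin (suc a) → Fin n) (segment : Fin (suc a) → KVertex n 4)
            (segment∈SP : ∀ s → SP (segment s))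
            (segment-∈ : ∀ s v → Iff (v ∈ proj₁ (segment s)) (∃ λ t → t < 4 × v ≡ g (shift s t)))
  where

  offset : ∀ {t} → t < 7 → t < suc a
  offset t<7 = <-≤-trans t<7 7≤N

  3≤N : 3 ≤ suc a
  3≤N = ≤-trans (m≤m+n 3 4) 7≤N

  segment-meets-or-avoids : ∀ s (Y : Subset n) {t₀} → t₀ < 4 → g (shift s t₀) ∉ Y →
    AvoidingPath SP (g (shift s t₀)) Y ⊎ ∃ λ t → t < 4 × t ≢ t₀ × g (shift s t) ∈ Y
  segment-meets-or-avoids s Y {t₀} t₀<4 x∉Y with anyUpTo? (λ t → g (shift s t) ∈? Y) 4
  ... | yes (t , t<4 , gt∈Y) = inj₂ (t , t<4 , (λ t≡t₀ → x∉Y (subst (λ z → g (shift s z) ∈ Y) t≡t₀ gt∈Y)) , gt∈Y)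
  ... | no no-hit = inj₁ (segment s , segment∈SP s , proj₂ (segment-∈ s _) (t₀ , t₀<4 , refl) , avoids)
    where
      avoids : Disjoint (proj₁ (segment s)) Y
      avoids v v∈seg v∈Y with proj₁ (segment-∈ s v) v∈seg
      ... | t , t<4 , refl = no-hit (t , t<4 , v∈Y)

  left-end : ∀ i → g (shift (back 3 i) 3) ≡ g i
  left-end i = cong g (shift-back i 3≤N)

  right-end : ∀ i → g (shift i 0) ≡ g i
  right-end i = cong g (shift-0 i)

  two-sides : ∀ {i Y t₁ t₂} → t₁ < 4 → t₁ ≢ 3 → t₂ < 4 → t₂ ≢ 0 →
              g (shift (back 3 i) t₁) ∈ Y → g (shift i t₂) ∈ Y → Flanks g i Y
  two-sides {i} {Y} {t₁} {t₂} t₁<4 t₁≢3 t₂<4 t₂≢0 left∈Y right∈Y = record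
    { x₁ = shift (back 3 i) t₁ ; x₂ = shift i t₂
    ; x₁≢x₀ = λ e → t₁≢3 (shift-injective (back 3 i) (offset (below-7 t₁<4)) (offset (below-7 (n<1+n 3)))
                            (trans e (sym (shift-back i 3≤N))))
    ; x₂≢x₀ = λ e → t₂≢0 (shift-injective i (offset (below-7 t₂<4)) (offset (s≤s z≤n))
                            (trans e (sym (shift-0 i))))
    ; x₁≢x₂ = λ e → left≢right t₁<4 t₂≢0 (shift-injective (back 3 i) (offset (below-7 t₁<4))
                                           (offset (+-monoʳ-< 3 t₂<4)) (trans e right-from-left))
    ; gx₁∈Y = left∈Y ; gx₂∈Y = right∈Y }
    where
      right-from-left : shift i t₂ ≡ shift (back 3 i) (3 + t₂)
      right-from-left = trans (cong (λ z → shift z t₂) (sym (shift-back i 3≤N))) (shift-+ (back 3 i) 3 t₂)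

  -- The cross lemma along g: the two segments ending at g i avoid Y, or Y flanks g i.
  line-flanks : ∀ i (Y : Subset n) → g i ∉ Y → AvoidingPath SP (g i) Y ⊎ Flanks g i Y
  line-flanks i Y gi∉Y
    with segment-meets-or-avoids (back 3 i) Y (n<1+n 3) (gi∉Y ∘ subst (_∈ Y) (left-end i))
       | segment-meets-or-avoids i Y (s≤s z≤n) (gi∉Y ∘ subst (_∈ Y) (right-end i))
  ... | inj₁ P | _      = inj₁ (subst (λ x → AvoidingPath SP x Y) (left-end i) P)
  ... | inj₂ _ | inj₁ P = inj₁ (subst (λ x → AvoidingPath SP x Y) (right-end i) P)
  ... | inj₂ (t₁ , t₁<4 , t₁≢3 , left∈Y) | inj₂ (t₂ , t₂<4 , t₂≢0 , right∈Y) =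
    inj₂ (two-sides t₁<4 t₁≢3 t₂<4 t₂≢0 left∈Y right∈Y)


-- The torus C_(a+1) □ C_(b+1); the cycle lengths are written suc a and suc b
-- so that shift computes.
module Torus (a b : ℕ) where

  horizontal : ℕ → Fin (suc a) → Fin (suc b) → Subset (suc a * suc b)
  horizontal m i j = range (λ t → combine (shift i t) j) m

  vertical : ℕ → Fin (suc a) → Fin (suc b) → Subset (suc a * suc b)
  vertical m i j = range (λ t → combine i (shift j t)) m

  horizontal-is-path : ∀ m i j → HorizPath m i j (horizontal m i j)
  horizontal-is-path m i j = range-∈ (λ t → combine (shift i t) j) m

  vertical-is-path : ∀ m i j → VertPath m i j (vertical m i j)
  vertical-is-path m i j = range-∈ (λ t → combine i (shift j t)) m

  hpath : ∀ {m} → m ≤ suc a → Fin (suc a) → Fin (suc b) → KVertex (suc a * suc b) m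
  hpath {m} m≤A i j = horizontal m i j , range-size _ m λ s<t t<m e →
    <⇒≢ s<t (shift-injective i (<-trans s<t (<-≤-trans t<m m≤A)) (<-≤-trans t<m m≤A)
               (combine-injectiveˡ _ j _ j e))

  vpath : ∀ {m} → m ≤ suc b → Fin (suc a) → Fin (suc b) → KVertex (suc a * suc b) m
  vpath {m} m≤B i j = vertical m i j , range-size _ m λ s<t t<m e →
    <⇒≢ s<t (shift-injective j (<-trans s<t (<-≤-trans t<m m≤B)) (<-≤-trans t<m m≤B)
               (proj₂ (combine-injective i _ i _ e)))

  module Listing (m : ℕ) (m≤A : m ≤ suc a) (m≤B : m ≤ suc b) where

    starting-at : Fin (suc a * suc b) → Fin (suc a) × Fin (suc b)
    starting-at = remQuot {suc a} (suc b)

    h-at v-at : Fin (suc a * suc b) → KVertex (suc a * suc b) m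
    h-at v = hpath m≤A (proj₁ (starting-at v)) (proj₂ (starting-at v))
    v-at v = vpath m≤B (proj₁ (starting-at v)) (proj₂ (starting-at v))

    straight-paths : List (KVertex (suc a * suc b) m)
    straight-paths = map h-at (allFin _) ++ map v-at (allFin _)

    straight-path-listed : ∀ X → StraightPath (suc a) (suc b) m (proj₁ X) → X ∈ₗ straight-paths
    straight-path-listed X (i , j , inj₁ X-horizontal) =
      ∈-++⁺ˡ (subst (_∈ₗ map h-at (allFin _)) h-at≡X (∈-map⁺ h-at (∈-allFin (combine i j))))
      where
        h-at≡X : h-at (combine i j) ≡ X
        h-at≡X = trans (cong (λ p → hpath m≤A (proj₁ p) (proj₂ p)) (remQuot-combine i j))
                       (vertex-≡ (same-members _ (horizontal-is-path m i j) X-horizontal))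
    straight-path-listed X (i , j , inj₂ X-vertical) =
      ∈-++⁺ʳ (map h-at (allFin _)) (subst (_∈ₗ map v-at (allFin _)) v-at≡X (∈-map⁺ v-at (∈-allFin (combine i j))))
      where
        v-at≡X : v-at (combine i j) ≡ X
        v-at≡X = trans (cong (λ p → vpath m≤B (proj₁ p) (proj₂ p)) (remQuot-combine i j))
                       (vertex-≡ (same-members _ (vertical-is-path m i j) X-vertical))

    straight-paths-length : length straight-paths ≤ 2 * (suc a * suc b)
    straight-paths-length = ≤-reflexive (begin
      length straight-paths     ≡⟨ length-++ (map h-at (allFin N)) ⟩
      length (map h-at (allFin N)) + length (map v-at (allFin N))
                                ≡⟨ cong₂ _+_ (all-vertices h-at) (all-vertices v-at) ⟩
      N + N                     ≡⟨ cong (N +_) (sym (+-identityʳ N)) ⟩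
      2 * N                     ∎)
      where
        open ≡-Reasoning
        N : ℕ
        N = suc a * suc b
        all-vertices : (f : Fin N → KVertex N m) → length (map f (allFin N)) ≡ N
        all-vertices f = trans (length-map f (allFin N)) (length-tabulate (λ x → x))

  module Resolution (7≤A : 7 ≤ suc a) (7≤B : 7 ≤ suc b) where

    SP : KVertex (suc a * suc b) 4 → Set
    SP X = StraightPath (suc a) (suc b) 4 (proj₁ X)

    4≤A : 4 ≤ suc a
    4≤A = ≤-trans (m≤m+n 4 3) 7≤A

    4≤B : 4 ≤ suc b
    4≤B = ≤-trans (m≤m+n 4 3) 7≤B

    module Row (j : Fin (suc b)) =
      Line {SP = SP} 7≤A (λ c → combine c j) (λ s → hpath 4≤A s j)
           (λ s → s , j , inj₁ (horizontal-is-path 4 s j)) (λ s → horizontal-is-path 4 s j)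

    module Column (i : Fin (suc a)) =
      Line {SP = SP} 7≤B (combine i) (λ s → vpath 4≤B i s)
           (λ s → i , s , inj₂ (vertical-is-path 4 i s)) (λ s → vertical-is-path 4 i s)

    torus : Grid SP
    torus = record
      { I = Fin (suc a) ; J = Fin (suc b) ; pt = combine
      ; pt-injective = λ e → combine-injective _ _ _ _ e
      ; pt-surjective = λ v → proj₁ (remQuot {suc a} (suc b) v) , proj₂ (remQuot {suc a} (suc b) v)
                              , sym (combine-remQuot {suc a} (suc b) v)
      ; cross = cross }
      where
        cross : ∀ i j Y → combine i j ∉ Y → AvoidingPath SP (combine i j) Y ⊎ Cross combine i j Y
        cross i j Y ij∉Y with Row.line-flanks j i Y ij∉Y | Column.line-flanks i j Y ij∉Y
        ... | inj₁ P   | _        = inj₁ P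
        ... | inj₂ _   | inj₁ P   = inj₁ P
        ... | inj₂ row | inj₂ col = inj₂ (row , col)

    room : 3 * 4 ≤ suc a * suc b
    room = ≤-trans (m≤m+n 12 37) (*-mono-≤ 7≤A 7≤B)

    resolving : Resolving SP
    resolving = Kneser.resolving-by-separation room (GridSeparation.separated torus)


theorem4p7 : (a b : ℕ) → 10 ≤ a → 10 ≤ b →
    Resolving {a * b} {4} (λ X → StraightPath a b 4 (proj₁ X))
    × MetricDimLe (a * b) 4 (2 * (a * b))
theorem4p7 zero    _       () _
theorem4p7 (suc _) zero    _  ()
theorem4p7 (suc a) (suc b) 10≤A 10≤B =
  resolving , straight-paths , resolving-mono straight-path-listed resolving , straight-paths-length
  where
    open Torus a b
    open Resolution (≤-trans (m≤m+n 7 3) 10≤A) (≤-trans (m≤m+n 7 3) 10≤B) using (resolving)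
    open Listing 4 (≤-trans (m≤m+n 4 6) 10≤A) (≤-trans (m≤m+n 4 6) 10≤B)
      using (straight-paths; straight-path-listed; straight-paths-length)
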